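{- For any integer $t\geq 3$, there exists a connected graph $G$ such that $fix(G)-F_{xt}(G)=t$.
   Context: All graphs are finite and simple. A fixing set of $G$ is a set $F\subseteq V(G)$ such that the only automorphism fixing every vertex of $F$ is the identity; $fix(G)$ is the minimum size of a fixing set. A fixatic partition is a partition of $V(G)$ into classes each of which is a fixing set; $F_{xt}(G)$ is the maximum number of classes in a fixatic partition. -}

module Defs where

open import Data.Nat using (ℕ; suc; _≤_)
open import Data.Bool using (Bool; true; false)
open import Data.Fin using (Fin; _≟_)
open import Data.Vec using (tabulate)
open import Relation.Nullary.Decidable using (⌊_⌋)
open import Data.Fin.Subset using (Subset; _∈_; ∣_∣)
open import Data.Fin.Permutation using (Permutation′; _⟨$⟩ʳ_)
open import Data.Product using (Σ; _×_; ∃)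
open import Relation.Binary.PropositionalEquality using (_≡_; _≢_)
open import Relation.Nullary using (¬_)

record Graph (n : ℕ) : Set where
  field
    adj    : Fin n → Fin n → Bool
    sym    : ∀ u v → adj u v ≡ adj v u
    irrefl : ∀ v → adj v v ≡ false
open Graph public

data Reach {n : ℕ} (G : Graph n) : Fin n → Fin n → Set where
  here : ∀ {v} → Reach G v v
  step : ∀ {u w v} → adj G u w ≡ true → Reach G w v → Reach G u v

Connected : ∀ {n} → Graph n → Set
Connected {n} G = Fin n × (∀ u v → Reach G u v)

IsAutomorphism : ∀ {n} → Graph n → Permutation′ n → Set
IsAutomorphism G σ = ∀ u v → adj G (σ ⟨$⟩ʳ u) (σ ⟨$⟩ʳ v) ≡ adj G u v

IsFixingSet : ∀ {n} → Graph n → Subset n → Set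
IsFixingSet {n} G F =
  (σ : Permutation′ n) → IsAutomorphism G σ →
  (∀ v → v ∈ F → σ ⟨$⟩ʳ v ≡ v) → ∀ v → σ ⟨$⟩ʳ v ≡ v

IsFixingNumber : ∀ {n} → Graph n → ℕ → Set
IsFixingNumber {n} G k =
  (Σ (Subset n) λ F → IsFixingSet G F × ∣ F ∣ ≡ k)
  × (∀ (F : Subset n) → IsFixingSet G F → k ≤ ∣ F ∣)

classOf : ∀ {n m} → (Fin n → Fin m) → Fin m → Subset n
classOf c j = tabulate (λ v → ⌊ c v ≟ j ⌋)

-- A fixatic partition into m classes: a labelling c : V → Fin m that is
-- surjective (all m classes nonempty) and each class is a fixing set.
IsFixaticPartition : ∀ {n} → Graph n → (m : ℕ) → (Fin n → Fin m) → Set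
IsFixaticPartition {n} G m c =
  (∀ (j : Fin m) → ∃ λ v → c v ≡ j)
  × (∀ (j : Fin m) → IsFixingSet G (classOf c j))

IsFixaticNumber : ∀ {n} → Graph n → ℕ → Set
IsFixaticNumber {n} G m =
  (Σ (Fin n → Fin m) λ c → IsFixaticPartition G m c)
  × (∀ (m′ : ℕ) (c : Fin n → Fin m′) → IsFixaticPartition G m′ c → m′ ≤ m)

module Submission where

-- For t ≥ 3 the witness is the complete graph K_{t+2}, for which
-- fix(K_{t+2}) = t + 1 and F_xt(K_{t+2}) = 1, so that the difference is t.
--
-- Every permutation of V(K_n) is an automorphism.  Hence a set F is a
-- fixing set exactly when it misses at most one vertex: if F missed two
-- vertices u ≠ v, the transposition (u v) would fix F pointwise without
-- being the identity; and an automorphism fixing all vertices but one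
-- fixes the last one too, by injectivity.  We only need the two halves
-- separately:
--   * a fixing set contains one of any two distinct vertices
--     ("pair-covering"), so its complement has at most one element and
--     |F| ≥ n - 1; the complement of a singleton shows fix(K_n) = n - 1;
--   * when n ≥ 3 two fixing sets F, G missing vertices u ∉ F, v ∉ G
--     meet: a third vertex w ∉ {u, v} is forced into both.  Two distinct
--     classes of a fixatic partition would be such a disjoint pair, so
--     F_xt(K_n) ≤ 1, and the trivial partition shows F_xt(K_n) = 1.

open import Defs
open import Data.Nat using (ℕ; _≤_; _+_; _∸_; suc; zero; z≤n; s≤s; s≤s⁻¹)
open import Data.Nat.Properties using (+-comm; +-monoʳ-≤; m≤n+m∸n; module ≤-Reasoning)
open import Data.Product using (Σ; _×_; _,_; ∃)
open import Data.Sum using (_⊎_; inj₁; inj₂)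
open import Data.Bool using (true; not)
open import Data.Fin using (Fin; _≟_) renaming (zero to fz; suc to fs)
open import Data.Fin.Subset using (Subset; _∈_; _∉_; _⊆_; ∣_∣; ∁; ⁅_⁆)
open import Data.Fin.Subset.Properties
  using (_∈?_; nonempty?; Empty-unique; x∈⁅x⁆; x∈⁅y⁆⇒x≡y; x∈∁p⇒x∉p; x∉p⇒x∈∁p;
         ∣∁p∣≡n∸∣p∣; ∣⁅x⁆∣≡1; ∣⊥∣≡0; p⊆q⇒∣p∣≤∣q∣)
open import Data.Fin.Permutation using (Permutation′; _⟨$⟩ʳ_; transpose)
open import Data.Vec using (lookup)
open import Data.Vec.Properties using (lookup∘tabulate; lookup⇒[]=; []=⇒lookup)
open import Function.Bundles using (Injection)
open import Function.Properties.Inverse using (↔⇒↣)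
open import Relation.Nullary using (yes; no; does)
open import Relation.Nullary.Decidable using (⌊_⌋; isYes≗does; dec-true; dec-false)
open import Relation.Nullary.Negation using (contradiction)
open import Relation.Binary.PropositionalEquality
  using (_≡_; _≢_; refl; trans; cong; subst; module ≡-Reasoning) renaming (sym to ≡-sym)

permutation-injective : ∀ {n} (σ : Permutation′ n) {u v : Fin n} →
  σ ⟨$⟩ʳ u ≡ σ ⟨$⟩ʳ v → u ≡ v
permutation-injective σ = Injection.injective (↔⇒↣ σ)

does-≟-injective : ∀ {n} (f : Fin n → Fin n) →
  (∀ {u v} → f u ≡ f v → u ≡ v) → ∀ u v → does (f u ≟ f v) ≡ does (u ≟ v)
does-≟-injective f inj u v with u ≟ v
... | yes refl = dec-true (f u ≟ f u) refl
... | no u≢v   = dec-false (f u ≟ f v) (λ e → u≢v (inj e))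

complete : (n : ℕ) → Graph n
complete n = record
  { adj    = λ u v → not (does (u ≟ v))
  ; sym    = λ u v → cong not (does-≟-symmetric u v)
  ; irrefl = λ v → cong not (dec-true (v ≟ v) refl)
  }
  where
  does-≟-symmetric : ∀ (u v : Fin n) → does (u ≟ v) ≡ does (v ≟ u)
  does-≟-symmetric u v with u ≟ v
  ... | yes u≡v = ≡-sym (dec-true (v ≟ u) (≡-sym u≡v))
  ... | no u≢v  = ≡-sym (dec-false (v ≟ u) (λ e → u≢v (≡-sym e)))

complete-adjacent : ∀ {n} {u v : Fin n} → u ≢ v → adj (complete n) u v ≡ true
complete-adjacent {u = u} {v} u≢v = cong not (dec-false (u ≟ v) u≢v)

complete-connected : ∀ k → Connected (complete (suc k))
complete-connected k = fz , reach
  where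
  reach : ∀ u v → Reach (complete (suc k)) u v
  reach u v with u ≟ v
  ... | yes refl = here
  ... | no u≢v   = step (complete-adjacent u≢v) here

complete-automorphism : ∀ {n} (σ : Permutation′ n) → IsAutomorphism (complete n) σ
complete-automorphism σ u v =
  cong not (does-≟-injective (σ ⟨$⟩ʳ_) (permutation-injective σ) u v)

PairCovering : ∀ {n} → Subset n → Set
PairCovering {n} F = ∀ (u v : Fin n) → u ≢ v → u ∈ F ⊎ v ∈ F

pairCovering-forces : ∀ {n} {F : Subset n} → PairCovering F →
  ∀ {v w} → v ∉ F → w ≢ v → w ∈ F
pairCovering-forces cover {v} {w} v∉F w≢v with cover w v w≢v
... | inj₁ w∈F = w∈F
... | inj₂ v∈F = contradiction v∈F v∉F

-- In K_n a fixing set is pair-covering: if it missed u ≠ v, the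
-- transposition (u v) would fix it pointwise but move u.
complete-fixing⇒pairCovering : ∀ {n} (F : Subset n) →
  IsFixingSet (complete n) F → PairCovering F
complete-fixing⇒pairCovering F fixing u v u≢v with u ∈? F | v ∈? F
... | yes u∈F | _       = inj₁ u∈F
... | no _    | yes v∈F = inj₂ v∈F
... | no u∉F  | no v∉F  = contradiction (trans (≡-sym fixes-u) swaps-u) u≢v
  where
  τ : Permutation′ _
  τ = transpose u v

  swaps-u : τ ⟨$⟩ʳ u ≡ v
  swaps-u rewrite dec-true (u ≟ u) refl = refl

  fixes-outside : ∀ w → w ∈ F → τ ⟨$⟩ʳ w ≡ w
  fixes-outside w w∈F
    rewrite dec-false (w ≟ u) (λ e → u∉F (subst (_∈ F) e w∈F))
          | dec-false (w ≟ v) (λ e → v∉F (subst (_∈ F) e w∈F)) = refl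

  fixes-u : τ ⟨$⟩ʳ u ≡ u
  fixes-u = fixing τ (complete-automorphism τ) fixes-outside u

-- A pair-covering subset of Fin (suc k) has at least k elements, since its
-- complement has at most one.
pairCovering-size : ∀ k (F : Subset (suc k)) → PairCovering F → k ≤ ∣ F ∣
pairCovering-size k F cover = s≤s⁻¹ (begin
  suc k                     ≤⟨ m≤n+m∸n (suc k) ∣ F ∣ ⟩
  ∣ F ∣ + (suc k ∸ ∣ F ∣)   ≡⟨ cong (∣ F ∣ +_) (≡-sym (∣∁p∣≡n∸∣p∣ F)) ⟩
  ∣ F ∣ + ∣ ∁ F ∣           ≤⟨ +-monoʳ-≤ ∣ F ∣ complement-size ⟩
  ∣ F ∣ + 1                 ≡⟨ +-comm ∣ F ∣ 1 ⟩
  suc ∣ F ∣                 ∎)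
  where
  open ≤-Reasoning

  complement-size : ∣ ∁ F ∣ ≤ 1
  complement-size with nonempty? (∁ F)
  ... | yes (v , v∈∁F) = subst (∣ ∁ F ∣ ≤_) (∣⁅x⁆∣≡1 v) (p⊆q⇒∣p∣≤∣q∣ complement⊆⁅v⁆)
    where
    complement⊆⁅v⁆ : ∁ F ⊆ ⁅ v ⁆
    complement⊆⁅v⁆ {w} w∈∁F with w ≟ v
    ... | yes refl = x∈⁅x⁆ w
    ... | no w≢v   = contradiction (pairCovering-forces cover (x∈∁p⇒x∉p v∈∁F) w≢v)
                                   (x∈∁p⇒x∉p w∈∁F)
  ... | no empty rewrite Empty-unique empty | ∣⊥∣≡0 (suc k) = z≤n

-- In K_n the complement of a single vertex v is a fixing set: an
-- automorphism fixing every other vertex cannot send v elsewhere.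
complete-allButOne-fixing : ∀ {n} (v : Fin n) → IsFixingSet (complete n) (∁ ⁅ v ⁆)
complete-allButOne-fixing v σ _ fixes w with w ≟ v
... | no w≢v   = fixes w (x∉p⇒x∈∁p (λ w∈⁅v⁆ → w≢v (x∈⁅y⁆⇒x≡y v w∈⁅v⁆)))
... | yes refl with σ ⟨$⟩ʳ w ≟ w
...   | yes σw≡w = σw≡w
...   | no σw≢w  = contradiction (permutation-injective σ σ-fixes-σw) σw≢w
  where
  σ-fixes-σw : σ ⟨$⟩ʳ (σ ⟨$⟩ʳ w) ≡ σ ⟨$⟩ʳ w
  σ-fixes-σw = fixes (σ ⟨$⟩ʳ w) (x∉p⇒x∈∁p (λ σw∈⁅w⁆ → σw≢w (x∈⁅y⁆⇒x≡y w σw∈⁅w⁆)))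

complete-fixingNumber : ∀ k → IsFixingNumber (complete (suc k)) k
complete-fixingNumber k =
  (∁ ⁅ fz ⁆ , complete-allButOne-fixing fz , allButOne-size)
  , λ F fixing → pairCovering-size k F (complete-fixing⇒pairCovering F fixing)
  where
  allButOne-size : ∣ ∁ ⁅ fz {k} ⁆ ∣ ≡ k
  allButOne-size = trans (∣∁p∣≡n∸∣p∣ ⁅ fz {k} ⁆) (cong (suc k ∸_) (∣⁅x⁆∣≡1 (fz {k})))

∈classOf⇒label : ∀ {n m} (c : Fin n → Fin m) {j v} → v ∈ classOf c j → c v ≡ j
∈classOf⇒label c {j} {v} v∈class
  with c v ≟ j | trans (≡-sym (lookup∘tabulate (λ w → ⌊ c w ≟ j ⌋) v)) ([]=⇒lookup v∈class)
... | yes cv≡j | _ = cv≡j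
... | no _     | ()

label⇒∈classOf : ∀ {n m} (c : Fin n → Fin m) {j v} → c v ≡ j → v ∈ classOf c j
label⇒∈classOf c {v = v} refl =
  lookup⇒[]= v _ (begin
    lookup (classOf c (c v)) v  ≡⟨ lookup∘tabulate (λ w → ⌊ c w ≟ c v ⌋) v ⟩
    ⌊ c v ≟ c v ⌋               ≡⟨ isYes≗does (c v ≟ c v) ⟩
    does (c v ≟ c v)            ≡⟨ dec-true (c v ≟ c v) refl ⟩
    true                        ∎)
  where open ≡-Reasoning

thirdVertex : ∀ {r} (u v : Fin (3 + r)) → ∃ λ w → w ≢ u × w ≢ v
thirdVertex fz          fz          = fs fz      , (λ ()) , (λ ())
thirdVertex fz          (fs fz)     = fs (fs fz) , (λ ()) , (λ ())
thirdVertex fz          (fs (fs _)) = fs fz      , (λ ()) , (λ ())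
thirdVertex (fs fz)     fz          = fs (fs fz) , (λ ()) , (λ ())
thirdVertex (fs fz)     (fs _)      = fz         , (λ ()) , (λ ())
thirdVertex (fs (fs _)) fz          = fs fz      , (λ ()) , (λ ())
thirdVertex (fs (fs _)) (fs _)      = fz         , (λ ()) , (λ ())

-- In K_n with n ≥ 3, two fixing sets that are not the whole vertex set
-- intersect: a vertex avoiding one missing vertex of each is forced into
-- both.
complete-fixingSets-meet : ∀ {r} {F G : Subset (3 + r)} →
  IsFixingSet (complete (3 + r)) F → IsFixingSet (complete (3 + r)) G →
  ∀ {u v} → u ∉ F → v ∉ G → ∃ λ w → w ∈ F × w ∈ G
complete-fixingSets-meet {F = F} {G} F-fixing G-fixing u∉F v∉G
  with thirdVertex _ _
... | w , w≢u , w≢v =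
  w , pairCovering-forces (complete-fixing⇒pairCovering F F-fixing) u∉F w≢u
    , pairCovering-forces (complete-fixing⇒pairCovering G G-fixing) v∉G w≢v

-- F_xt(K_n) = 1 for n ≥ 3: two distinct nonempty classes would be disjoint
-- fixing sets, each missing a vertex of the other.
complete-fixaticNumber : ∀ r → IsFixaticNumber (complete (3 + r)) 1
complete-fixaticNumber r = (trivial , trivial-onto , trivial-fixing) , atMostOne
  where
  K = complete (3 + r)

  trivial : Fin (3 + r) → Fin 1
  trivial _ = fz

  trivial-onto : ∀ j → ∃ λ v → trivial v ≡ j
  trivial-onto fz = fz , refl

  trivial-fixing : ∀ j → IsFixingSet K (classOf trivial j)
  trivial-fixing fz σ _ fixes v = fixes v (label⇒∈classOf trivial refl)

  distinctClasses-meet : ∀ {m} (c : Fin (3 + r) → Fin m) → IsFixaticPartition K m c →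
    ∀ {i j} → i ≢ j → ∃ λ w → c w ≡ i × c w ≡ j
  distinctClasses-meet c (onto , fixing) {i} {j} i≢j
    with onto i | onto j
  ... | u , cu≡i | v , cv≡j
    with complete-fixingSets-meet (fixing i) (fixing j) v∉class-i u∉class-j
    where
    v∉class-i : v ∉ classOf c i
    v∉class-i v∈ = i≢j (trans (≡-sym (∈classOf⇒label c v∈)) cv≡j)
    u∉class-j : u ∉ classOf c j
    u∉class-j u∈ = i≢j (trans (≡-sym cu≡i) (∈classOf⇒label c u∈))
  ... | w , w∈i , w∈j = w , ∈classOf⇒label c w∈i , ∈classOf⇒label c w∈j

  atMostOne : ∀ m (c : Fin (3 + r) → Fin m) → IsFixaticPartition K m c → m ≤ 1
  atMostOne zero          _ _         = z≤n
  atMostOne (suc zero)    _ _         = s≤s z≤n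
  atMostOne (suc (suc m)) c partition
    with distinctClasses-meet c partition {fz} {fs fz} (λ ())
  ... | w , cw≡0 , cw≡1 = contradiction (trans (≡-sym cw≡0) cw≡1) (λ ())

mainTheorem19 : (t : ℕ) → 3 ≤ t →
    Σ ℕ λ n → Σ (Graph n) λ G → Connected G ×
    (Σ ℕ λ f → Σ ℕ λ p →
    IsFixingNumber G f × IsFixaticNumber G p × f ≡ t + p)
mainTheorem19 t@(suc (suc (suc r))) (s≤s (s≤s (s≤s _))) =
  suc (suc t) , complete (suc (suc t)) , complete-connected (suc t) ,
  suc t , 1 , complete-fixingNumber (suc t) , complete-fixaticNumber (suc (suc r)) ,
  +-comm 1 t
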